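{- Let $\mathcal{A}$ be an infinite, uniformly locally finite, ultrahomogeneous computable structure for a finite language, and let $C\subseteq\mathbb{N}$ be cohesive. Then $\mathcal{A}\cong\Pi_C\mathcal{A}$.
   Context: A set $C\subseteq\mathbb{N}$ is cohesive if it is infinite and for every c.e. set $W$, either $C\setminus W$ or $C\cap W$ is finite. Write $X\subseteq^* Y$ if $X\setminus Y$ is finite. A computable structure has computable domain $A\subseteq\mathbb{N}$ and uniformly computable interpretations of its symbols. The cohesive power $\Pi_C\mathcal{A}$: its domain consists of the classes $[\varphi]$ of partial computable $\varphi\colon\mathbb{N}\to A$ with $C\subseteq^*\mathrm{dom}(\varphi)$, under $\varphi=_C\psi$ iff $C\subseteq^*\{x:\varphi(x)\downarrow=\psi(x)\downarrow\}$; an $n$-ary relation $R$ holds of $[\varphi_0],\dots,[\varphi_{n-1}]$ iff $C\subseteq^*\{x:\text{all }\varphi_i(x)\downarrow\text{ and }R^{\mathcal{A}}(\varphi_0(x),\dots,\varphi_{n-1}(x))\}$; an $n$-ary function $f$ sends $[\varphi_0],\dots,[\varphi_{n-1}]$ to $[\psi]$ where $\psi(x)\simeq f^{\mathcal{A}}(\varphi_0(x),\dots,\varphi_{n-1}(x))$; a constant $c$ is interpreted as the class of the constant function with value $c^{\mathcal{A}}$. A structure is uniformly locally finite if there is $f\colon\mathbb{N}\to\mathbb{N}$ such that every substructure generated by at most $n$ elements has at most $f(n)$ elements; it is ultrahomogeneous if every isomorphism between finitely generated substructures extends to an automorphism. -}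

module Defs where

open import Level using (0ℓ)
open import Data.Nat using (ℕ; zero; suc; _≤_; _<_; _⊔_)
open import Data.Nat.Properties using (≤-trans; m≤m⊔n; m≤n⊔m)
open import Data.Fin using (Fin)
open import Data.Vec using (Vec; []; _∷_; map; lookup)
open import Data.Vec.Relation.Unary.All using (All; []; _∷_)
open import Data.List using (List; length)
import Data.List.Relation.Unary.All as LAll
open import Data.List.Relation.Unary.Any using (Any)
open import Data.List.Relation.Unary.AllPairs using (AllPairs)
open import Data.Product using (Σ; ∃; _×_; _,_; proj₁; proj₂)
open import Data.Sum using (_⊎_)
open import Relation.Nullary using (¬_)
open import Relation.Binary.PropositionalEquality using (_≡_; refl)
open import Function.Bundles using (_⇔_)

data PR : ℕ → Set where
  Z  : ∀ {n} → PR n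
  S  : PR 1
  P  : ∀ {n} → Fin n → PR n
  Cn : ∀ {m n} → PR m → Vec (PR n) m → PR n
  Pr : ∀ {n} → PR n → PR (suc (suc n)) → PR (suc n)
  Mn : ∀ {n} → PR (suc n) → PR n

mutual
  data Eval : ∀ {n} → PR n → Vec ℕ n → ℕ → Set where
    evZ  : ∀ {n} {xs : Vec ℕ n} → Eval Z xs 0
    evS  : ∀ {x} → Eval S (x ∷ []) (suc x)
    evP  : ∀ {n} {i : Fin n} {xs} → Eval (P i) xs (lookup xs i)
    evCn : ∀ {m n} {g : PR m} {hs : Vec (PR n) m} {xs ys z} →
           EvalV hs xs ys → Eval g ys z → Eval (Cn g hs) xs z
    evPr0 : ∀ {n} {g : PR n} {h} {xs y} →
            Eval g xs y → Eval (Pr g h) (0 ∷ xs) y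
    evPrS : ∀ {n} {g : PR n} {h} {xs k r y} →
            Eval (Pr g h) (k ∷ xs) r → Eval h (k ∷ r ∷ xs) y →
            Eval (Pr g h) (suc k ∷ xs) y
    evMn : ∀ {n} {f : PR (suc n)} {xs y} →
           Eval f (y ∷ xs) 0 →
           (∀ z → z < y → Σ ℕ λ v → Eval f (z ∷ xs) (suc v)) →
           Eval (Mn f) xs y

  data EvalV : ∀ {m n} → Vec (PR n) m → Vec ℕ n → Vec ℕ m → Set where
    []  : ∀ {n} {xs : Vec ℕ n} → EvalV [] xs []
    _∷_ : ∀ {m n} {f : PR n} {fs : Vec (PR n) m} {xs y ys} →
          Eval f xs y → EvalV fs xs ys → EvalV (f ∷ fs) xs (y ∷ ys)

_⟨_⟩≃_ : PR 1 → ℕ → ℕ → Set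
e ⟨ x ⟩≃ y = Eval e (x ∷ []) y

_⟨_⟩↓ : PR 1 → ℕ → Set
e ⟨ x ⟩↓ = Σ ℕ λ y → e ⟨ x ⟩≃ y

Pred : Set₁
Pred = ℕ → Set

Finite : Pred → Set
Finite X = Σ ℕ λ b → ∀ x → X x → x < b

Infinite : Pred → Set
Infinite X = ∀ n → Σ ℕ λ m → n ≤ m × X m

_⊆*_ : Pred → Pred → Set
X ⊆* Y = Σ ℕ λ b → ∀ x → b ≤ x → X x → Y x

-- W_e = dom(φ_e); the c.e. sets are exactly the W_e
W : PR 1 → Pred
W e x = e ⟨ x ⟩↓

Cohesive : Pred → Set
Cohesive C = Infinite C × (∀ e → C ⊆* W e ⊎ Finite (λ x → C x × W e x))

record Language : Set where
  field
    nRel  : ℕ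
    relAr : Fin nRel → ℕ
    nFun  : ℕ
    funAr : Fin nFun → ℕ
    nCon  : ℕ

record Structure (L : Language) : Set₁ where
  open Language L
  field
    Carrier : Set
    _≈_     : Carrier → Carrier → Set
    rel     : (i : Fin nRel) → Vec Carrier (relAr i) → Set
    fun     : (i : Fin nFun) → Vec Carrier (funAr i) → Carrier
    con     : Fin nCon → Carrier

record Iso {L : Language} (A B : Structure L) : Set where
  open Language L
  module A = Structure A
  module B = Structure B
  field
    h     : A.Carrier → B.Carrier
    h-cong : ∀ {x y} → x A.≈ y → h x B.≈ h y
    h-inj  : ∀ {x y} → h x B.≈ h y → x A.≈ y
    h-surj : ∀ b → Σ A.Carrier λ a → h a B.≈ b
    h-rel  : ∀ i xs → A.rel i xs ⇔ B.rel i (map h xs)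
    h-fun  : ∀ i xs → h (A.fun i xs) B.≈ B.fun i (map h xs)
    h-con  : ∀ c → h (A.con c) B.≈ B.con c

_≅_ : {L : Language} → Structure L → Structure L → Set
A ≅ B = Iso A B

module _ {L : Language} (A : Structure L) where
  open Language L
  open Structure A

  data Gen (G : List Carrier) : Carrier → Set where
    gen-base : ∀ {x} → Any (_≈ x) G → Gen G x
    gen-con  : ∀ c → Gen G (con c)
    gen-fun  : ∀ i {xs} → All (Gen G) xs → Gen G (fun i xs)
    gen-resp : ∀ {x y} → Gen G x → x ≈ y → Gen G y

  private
    allGen : ∀ {G k} (xs : Vec (Σ Carrier (Gen G)) k) → All (Gen G) (map proj₁ xs)
    allGen [] = []
    allGen ((x , g) ∷ xs) = g ∷ allGen xs

  Sub : List Carrier → Structure L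
  Sub G = record
    { Carrier = Σ Carrier (Gen G)
    ; _≈_ = λ x y → proj₁ x ≈ proj₁ y
    ; rel = λ i xs → rel i (map proj₁ xs)
    ; fun = λ i xs → fun i (map proj₁ xs) , gen-fun i (allGen xs)
    ; con = λ c → con c , gen-con c
    }

  UniformlyLocallyFinite : Set
  UniformlyLocallyFinite =
    Σ (ℕ → ℕ) λ f → ∀ n (G : List Carrier) → length G ≤ n →
      ∀ (ys : List Carrier) → LAll.All (Gen G) ys →
      AllPairs (λ a b → ¬ (a ≈ b)) ys → length ys ≤ f n

  Ultrahomogeneous : Set
  Ultrahomogeneous =
    ∀ (G G' : List Carrier) (p : Sub G ≅ Sub G') →
      Σ (A ≅ A) λ σ → ∀ (x : Σ Carrier (Gen G)) →
        Iso.h σ (proj₁ x) ≈ proj₁ (Iso.h p x)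

-- Computable structures (finite language, so uniformity is automatic)

record CompStructure (L : Language) : Set where
  open Language L
  field
    domCode  : PR 1
    domTotal : ∀ x → domCode ⟨ x ⟩≃ 0 ⊎ domCode ⟨ x ⟩≃ 1
  Dom : Pred
  Dom x = domCode ⟨ x ⟩≃ 1
  field
    relCode  : (i : Fin nRel) → PR (relAr i)
    relTotal : ∀ i xs → All Dom xs → Eval (relCode i) xs 0 ⊎ Eval (relCode i) xs 1
    funCode  : (i : Fin nFun) → PR (funAr i)
    funTotal : ∀ i xs → All Dom xs → Σ ℕ λ y → Eval (funCode i) xs y
    funDom   : ∀ i xs y → All Dom xs → Eval (funCode i) xs y → Dom y
    conVal   : Fin nCon → ℕ
    conDom   : ∀ c → Dom (conVal c)

  private
    allDom : ∀ {k} (xs : Vec (Σ ℕ Dom) k) → All Dom (map proj₁ xs)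
    allDom [] = []
    allDom ((x , d) ∷ xs) = d ∷ allDom xs

  struct : Structure L
  struct = record
    { Carrier = Σ ℕ Dom
    ; _≈_ = λ x y → proj₁ x ≡ proj₁ y
    ; rel = λ i xs → Eval (relCode i) (map proj₁ xs) 1
    ; fun = λ i xs → let ad = allDom xs
                         t = funTotal i (map proj₁ xs) ad
                     in proj₁ t , funDom i _ (proj₁ t) ad (proj₂ t)
    ; con = λ c → conVal c , conDom c
    }

  InfiniteStructure : Set
  InfiniteStructure = Infinite Dom

constCode : ℕ → PR 1
constCode zero = Z
constCode (suc n) = Cn S (constCode n ∷ [])

constCode-ev : ∀ n x → constCode n ⟨ x ⟩≃ n
constCode-ev zero x = evZ
constCode-ev (suc n) x = evCn (constCode-ev n x ∷ []) evS

constCode-det : ∀ n x y → constCode n ⟨ x ⟩≃ y → y ≡ n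
constCode-det zero x .0 evZ = refl
constCode-det (suc n) x y (evCn (e ∷ []) evS) with constCode-det n x _ e
... | refl = refl

module CohesivePower {L : Language} (𝒜 : CompStructure L) (C : Pred) where
  open Language L
  open CompStructure 𝒜

  record PC : Set where
    constructor pc
    field
      code : PR 1
      vals : ∀ x y → code ⟨ x ⟩≃ y → Dom y
      dom  : C ⊆* W code
  open PC

  private
    valsV : ∀ {k} (xs : Vec PC k) x ys → EvalV (map code xs) (x ∷ []) ys → All Dom ys
    valsV [] x [] [] = []
    valsV (φ ∷ xs) x (y ∷ ys) (e ∷ es) = vals φ x y e ∷ valsV xs x ys es

    domV : ∀ {k} (xs : Vec PC k) →
           Σ ℕ λ b → ∀ x → b ≤ x → C x → Σ (Vec ℕ k) λ ys → EvalV (map code xs) (x ∷ []) ys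
    domV [] = 0 , λ x _ _ → [] , []
    domV (φ ∷ xs) with dom φ | domV xs
    ... | (b₁ , d₁) | (b₂ , d₂) = b₁ ⊔ b₂ , λ x le cx →
      let (y , e) = d₁ x (≤-trans (m≤m⊔n b₁ b₂) le) cx
          (ys , es) = d₂ x (≤-trans (m≤n⊔m b₁ b₂) le) cx
      in y ∷ ys , e ∷ es

  funPC : (i : Fin nFun) → Vec PC (funAr i) → PC
  funPC i xs = record
    { code = Cn (funCode i) (map code xs)
    ; vals = λ { x y (evCn es e) → funDom i _ y (valsV xs x _ es) e }
    ; dom = let (b , d) = domV xs in b , λ x le cx →
              let (ys , es) = d x le cx
                  (y , e) = funTotal i ys (valsV xs x ys es)
              in y , evCn es e
    }

  conPC : Fin nCon → PC
  conPC c = record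
    { code = constCode (conVal c)
    ; vals = λ x y e → Relation.Binary.PropositionalEquality.subst Dom
               (Relation.Binary.PropositionalEquality.sym (constCode-det (conVal c) x y e))
               (conDom c)
    ; dom = 0 , λ x _ _ → conVal c , constCode-ev (conVal c) x
    }

  power : Structure L
  power = record
    { Carrier = PC
    ; _≈_ = λ φ ψ → C ⊆* (λ x → Σ ℕ λ y → code φ ⟨ x ⟩≃ y × code ψ ⟨ x ⟩≃ y)
    ; rel = λ i φs → C ⊆* (λ x → Σ (Vec ℕ (relAr i)) λ ys →
                         EvalV (map code φs) (x ∷ []) ys × Eval (relCode i) ys 1)
    ; fun = funPC
    ; con = conPC
    }

Π[_]_ : {L : Language} → Pred → CompStructure L → Structure L
Π[ C ] 𝒜 = CohesivePower.power 𝒜 C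

-- Back and forth between A and Π_C A along an enumeration of the elements of A and of all codes
-- of partial computable functions. The invariant: for C-almost every x, the functions chosen so far
-- take at x the values of an automorphic image of the elements chosen so far. Uniform local
-- finiteness makes the atomic type of an n-tuple determined by finitely many atoms, and
-- ultrahomogeneity makes the atomic type determine the orbit; so orbits are decided by a program.
-- Forth: the new function searches, at each x, for a value putting the extended tuple in the right
-- orbit. Back: by cohesiveness each of those finitely many atoms is eventually constant along C at
-- the extended tuple of values, so one point x₀ of C shows which element to adjoin.

module Submission where

open import Defs
open import Level using (0ℓ)
open import Axiom.ExcludedMiddle using (ExcludedMiddle)
open import Data.Nat
  using (ℕ; zero; suc; _+_; _∸_; _*_; _≤_; _<_; _⊔_; _≤′_; ≤′-refl; ≤′-step; pred; s≤s; _≟_)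
open import Data.Nat.Properties
  using (<-cmp; +-suc; +-identityʳ; pred[m∸n]≡m∸[1+n]; m+n≡0⇒m≡0; m+n≡0⇒n≡0; m∸n≡0⇒m≤n; n∸n≡0;
         ≤-antisym; m<1+n⇒m<n∨m≡n; even≢odd; *-cancelˡ-≡; suc-injective; 0≢1+n; 1+n≢0;
         ≤-refl; ≤-reflexive; ≤-trans; n≤1+n; m≤n⇒m≤1+n; ≤-pred; <-irrefl; ≤-<-trans; m≤m⊔n; m≤n⊔m; ≤⇒≤′)
open import Data.Fin using (Fin; zero; suc; toℕ)
open import Data.Fin.Properties using (toℕ-injective)
open import Data.Vec using (Vec; []; _∷_; lookup; map; toList)
open import Data.Vec.Properties using (lookup-map; map-id; length-toList)
open import Data.Vec.Relation.Unary.All using (All; []; _∷_)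
open import Data.List using (List; []; _∷_; length; _++_; allFin; concatMap; cartesianProductWith)
import Data.List as List
import Data.List.Relation.Unary.All as ListAll
open import Data.List.Relation.Unary.Any using (Any; here; there)
open import Data.List.Relation.Unary.AllPairs using (AllPairs; []; _∷_)
open import Data.List.Membership.Propositional using (_∈_; lose)
open import Data.List.Membership.Propositional.Properties
  using (∈-++⁺ˡ; ∈-++⁺ʳ; ∈-map⁺; ∈-allFin; ∈-concatMap⁺; ∈-cartesianProductWith⁺)
open import Data.Product using (Σ; _×_; _,_; proj₁; proj₂; map₁)
open import Data.Sum using (_⊎_; inj₁; inj₂)
open import Data.Unit using (⊤; tt)
open import Data.Empty using (⊥-elim)
open import Function.Bundles using (_⇔_; mk⇔; Equivalence)
import Function.Properties.Equivalence as ⇔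
open import Relation.Nullary using (¬_; Dec; yes; no)
import Relation.Nullary.Decidable as Dec
open import Relation.Binary using (tri<; tri≈; tri>)
open import Relation.Binary.PropositionalEquality
  using (_≡_; _≢_; refl; sym; trans; cong; cong₂; subst; subst₂)

mutual
  Eval-deterministic : ∀ {n} {f : PR n} {xs y y′} → Eval f xs y → Eval f xs y′ → y ≡ y′
  Eval-deterministic evZ evZ = refl
  Eval-deterministic evS evS = refl
  Eval-deterministic evP evP = refl
  Eval-deterministic (evCn es e) (evCn es′ e′) with EvalV-deterministic es es′
  ... | refl = Eval-deterministic e e′
  Eval-deterministic (evPr0 e) (evPr0 e′) = Eval-deterministic e e′
  Eval-deterministic (evPrS e h) (evPrS e′ h′) with Eval-deterministic e e′
  ... | refl = Eval-deterministic h h′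
  Eval-deterministic {y = y} {y′} (evMn e below) (evMn e′ below′) with <-cmp y y′
  ... | tri< y<y′ _ _ = ⊥-elim (0≢1+n (Eval-deterministic e (proj₂ (below′ y y<y′))))
  ... | tri≈ _ y≡y′ _ = y≡y′
  ... | tri> _ _ y′<y = ⊥-elim (0≢1+n (Eval-deterministic e′ (proj₂ (below y′ y′<y))))

  EvalV-deterministic : ∀ {m n} {fs : Vec (PR n) m} {xs ys ys′} →
                        EvalV fs xs ys → EvalV fs xs ys′ → ys ≡ ys′
  EvalV-deterministic [] [] = refl
  EvalV-deterministic (e ∷ es) (e′ ∷ es′) =
    cong₂ _∷_ (Eval-deterministic e e′) (EvalV-deterministic es es′)

addP : PR 2
addP = Pr (P zero) (Cn S (P (suc zero) ∷ []))

addP-eval : ∀ k x → Eval addP (k ∷ x ∷ []) (k + x)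
addP-eval zero    x = evPr0 evP
addP-eval (suc k) x = evPrS (addP-eval k x) (evCn (evP ∷ []) evS)

predP : PR 1
predP = Pr Z (P zero)

predP-eval : ∀ k → Eval predP (k ∷ []) (pred k)
predP-eval zero    = evPr0 evZ
predP-eval (suc k) = evPrS (predP-eval k) evP

monusP : PR 2
monusP = Pr (P zero) (Cn predP (P (suc zero) ∷ []))

monusP-eval : ∀ k x → Eval monusP (k ∷ x ∷ []) (x ∸ k)
monusP-eval zero    x = evPr0 evP
monusP-eval (suc k) x = subst (Eval monusP (suc k ∷ x ∷ [])) (pred[m∸n]≡m∸[1+n] x k)
  (evPrS (monusP-eval k x) (evCn (evP ∷ []) (predP-eval (x ∸ k))))

distP : PR 2
distP = Cn addP (Cn monusP (P (suc zero) ∷ P zero ∷ []) ∷ Cn monusP (P zero ∷ P (suc zero) ∷ []) ∷ [])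

distP-eval : ∀ x y → Eval distP (x ∷ y ∷ []) ((x ∸ y) + (y ∸ x))
distP-eval x y = evCn (evCn (evP ∷ evP ∷ []) (monusP-eval y x) ∷ evCn (evP ∷ evP ∷ []) (monusP-eval x y) ∷ [])
                      (addP-eval (x ∸ y) (y ∸ x))

isZeroP : PR 1
isZeroP = Pr (Cn S (Z ∷ [])) Z

isZero : ℕ → ℕ
isZero zero    = 1
isZero (suc _) = 0

isZeroP-eval : ∀ k → Eval isZeroP (k ∷ []) (isZero k)
isZeroP-eval zero    = evPr0 (evCn (evZ ∷ []) evS)
isZeroP-eval (suc k) = evPrS (isZeroP-eval k) evZ

ZeroIff : ∀ {n} → PR n → Vec ℕ n → Set → Set
ZeroIff e xs Φ = Σ ℕ λ m → Eval e xs m × (m ≡ 0 ⇔ Φ)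

module _ {n} {e : PR n} {xs : Vec ℕ n} {Φ : Set} where

  ZeroIff-resp : ∀ {Ψ} → Φ ⇔ Ψ → ZeroIff e xs Φ → ZeroIff e xs Ψ
  ZeroIff-resp Φ⇔Ψ (m , ev , m≡0⇔Φ) = m , ev , ⇔.trans m≡0⇔Φ Φ⇔Ψ

  ZeroIff-sound : ZeroIff e xs Φ → ∀ {m} → Eval e xs m → m ≡ 0 ⇔ Φ
  ZeroIff-sound (m , ev , m≡0⇔Φ) ev′ rewrite Eval-deterministic ev′ ev = m≡0⇔Φ

  ZeroIff-dec : ZeroIff e xs Φ → Dec Φ
  ZeroIff-dec (m , _ , m≡0⇔Φ) = Dec.map m≡0⇔Φ (m ≟ 0)

Z-ZeroIff : ∀ {n} {xs : Vec ℕ n} → ZeroIff Z xs ⊤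
Z-ZeroIff = 0 , evZ , mk⇔ (λ _ → tt) (λ _ → refl)

Cn-ZeroIff : ∀ {m n} {e : PR m} {gs : Vec (PR n) m} {xs ys Φ} →
             EvalV gs xs ys → ZeroIff e ys Φ → ZeroIff (Cn e gs) xs Φ
Cn-ZeroIff evs (m , ev , m≡0⇔Φ) = m , evCn evs ev , m≡0⇔Φ

addP-ZeroIff : ∀ {n} {e e′ : PR n} {xs Φ Ψ} → ZeroIff e xs Φ → ZeroIff e′ xs Ψ →
               ZeroIff (Cn addP (e ∷ e′ ∷ [])) xs (Φ × Ψ)
addP-ZeroIff (m , ev , m≡0⇔Φ) (m′ , ev′ , m′≡0⇔Ψ) =
  m + m′ , evCn (ev ∷ ev′ ∷ []) (addP-eval m m′) ,
  mk⇔ (λ eq → Equivalence.to m≡0⇔Φ (m+n≡0⇒m≡0 m eq) , Equivalence.to m′≡0⇔Ψ (m+n≡0⇒n≡0 m eq))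
      (λ (p , q) → cong₂ _+_ (Equivalence.from m≡0⇔Φ p) (Equivalence.from m′≡0⇔Ψ q))

notP : ∀ {n} → PR n → PR n
notP e = Cn isZeroP (e ∷ [])

notP-ZeroIff : ∀ {n} {e : PR n} {xs Φ} → ZeroIff e xs Φ → ZeroIff (notP e) xs (¬ Φ)
notP-ZeroIff (zero , ev , m≡0⇔Φ) =
  1 , evCn (ev ∷ []) (isZeroP-eval 0) , mk⇔ (λ ()) (λ ¬p → ⊥-elim (¬p (Equivalence.to m≡0⇔Φ refl)))
notP-ZeroIff (suc m , ev , m≡0⇔Φ) =
  0 , evCn (ev ∷ []) (isZeroP-eval (suc m)) ,
  mk⇔ (λ _ p → 1+n≢0 (Equivalence.from m≡0⇔Φ p)) (λ _ → refl)

characteristic-ZeroIff : ∀ {n} {e : PR n} {xs} → Eval e xs 0 ⊎ Eval e xs 1 → ZeroIff (notP e) xs (Eval e xs 1)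
characteristic-ZeroIff (inj₁ ev₀) =
  1 , evCn (ev₀ ∷ []) (isZeroP-eval 0) , mk⇔ (λ ()) (λ ev₁ → ⊥-elim (0≢1+n (Eval-deterministic ev₀ ev₁)))
characteristic-ZeroIff (inj₂ ev₁) = 0 , evCn (ev₁ ∷ []) (isZeroP-eval 1) , mk⇔ (λ _ → ev₁) (λ _ → refl)

∸-distance≡0⇔≡ : ∀ x y → (x ∸ y) + (y ∸ x) ≡ 0 ⇔ x ≡ y
∸-distance≡0⇔≡ x y = mk⇔
  (λ eq → ≤-antisym (m∸n≡0⇒m≤n (m+n≡0⇒m≡0 (x ∸ y) eq)) (m∸n≡0⇒m≤n (m+n≡0⇒n≡0 (x ∸ y) eq)))
  (λ { refl → cong₂ _+_ (n∸n≡0 x) (n∸n≡0 x) })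

distP-ZeroIff : ∀ {n} {e e′ : PR n} {xs a b} → Eval e xs a → Eval e′ xs b →
                ZeroIff (Cn distP (e ∷ e′ ∷ [])) xs (a ≡ b)
distP-ZeroIff {a = a} {b} ev ev′ = _ , evCn (ev ∷ ev′ ∷ []) (distP-eval a b) , ∸-distance≡0⇔≡ a b

weaken : PR 1 → PR 2
weaken e = Cn e (P (suc zero) ∷ [])

weaken-EvalV : ∀ {m} {es : Vec (PR 1) m} {z x ys} → EvalV es (x ∷ []) ys → EvalV (map weaken es) (z ∷ x ∷ []) ys
weaken-EvalV []         = []
weaken-EvalV (ev ∷ evs) = evCn (evP ∷ []) ev ∷ weaken-EvalV evs

-- The search ignores its variable, so it halts at x exactly when e(x) = 0.
zeroSet : PR 1 → PR 1
zeroSet e = Mn (weaken e)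

W-zeroSet : ∀ {e x Φ} → ZeroIff e (x ∷ []) Φ → W (zeroSet e) x ⇔ Φ
W-zeroSet z = mk⇔ (λ { (_ , evMn (evCn (evP ∷ []) ev₀) _) → Equivalence.to (ZeroIff-sound z ev₀) refl })
                  (λ p → let (m , ev , m≡0⇔Φ) = z in
                         0 , evMn (evCn (evP ∷ []) (subst (Eval _ _) (Equivalence.from m≡0⇔Φ p) ev)) (λ _ ()))

Mn-complete : ∀ {n} {f : PR (suc n)} {xs} → (∀ z → Σ ℕ (Eval f (z ∷ xs))) →
              ∀ {z₀} → Eval f (z₀ ∷ xs) 0 → Σ ℕ (Eval (Mn f) xs)
Mn-complete {f = f} {xs} total {z₀} zero₀ = search z₀ 0 refl (λ _ ())
  where
  search : ∀ k b → b + k ≡ z₀ → (∀ z → z < b → Σ ℕ λ v → Eval f (z ∷ xs) (suc v)) →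
           Σ ℕ (Eval (Mn f) xs)
  search k b b+k≡z₀ below with total b
  ... | zero , ev = b , evMn ev below
  search zero b b+0≡z₀ below | suc v , ev
    rewrite +-identityʳ b | b+0≡z₀ = ⊥-elim (1+n≢0 (Eval-deterministic ev zero₀))
  search (suc k) b b+k≡z₀ below | suc v , ev = search k (suc b) (trans (sym (+-suc b k)) b+k≡z₀) below′
    where
    below′ : ∀ z → z < suc b → Σ ℕ λ v → Eval f (z ∷ xs) (suc v)
    below′ z z<1+b with m<1+n⇒m<n∨m≡n z<1+b
    ... | inj₁ z<b  = below z z<b
    ... | inj₂ refl = v , ev

Mn-zero : ∀ {n} {f : PR (suc n)} {xs y} → Eval (Mn f) xs y → Eval f (y ∷ xs) 0
Mn-zero (evMn ev₀ _) = ev₀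

-- Injective but not onto (a counts trailing 1-bits), which is why codes are later chosen classically.
pair : ℕ → ℕ → ℕ
pair zero    b = 2 * b
pair (suc a) b = suc (2 * pair a b)

pair-injective : ∀ {a b a′ b′} → pair a b ≡ pair a′ b′ → a ≡ a′ × b ≡ b′
pair-injective {zero}  {b} {zero}  {b′} eq = refl , *-cancelˡ-≡ b b′ 2 eq
pair-injective {zero}  {b} {suc a′} {b′} eq = ⊥-elim (even≢odd b (pair a′ b′) eq)
pair-injective {suc a} {b} {zero}  {b′} eq = ⊥-elim (even≢odd b′ (pair a b) (sym eq))
pair-injective {suc a} {b} {suc a′} {b′} eq =
  map₁ (cong suc) (pair-injective {a} {b} {a′} {b′} (*-cancelˡ-≡ (pair a b) (pair a′ b′) 2 (suc-injective eq)))

tag : ∀ {n} → PR n → ℕ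
tag Z        = 0
tag S        = 1
tag (P _)    = 2
tag (Cn _ _) = 3
tag (Pr _ _) = 4
tag (Mn _)   = 5

mutual
  encode : ∀ {n} → PR n → ℕ
  encode p = pair (tag p) (fields p)

  fields : ∀ {n} → PR n → ℕ
  fields Z            = 0
  fields S            = 0
  fields (P i)        = toℕ i
  fields (Cn {m} g hs) = pair m (pair (encode g) (encodeV hs))
  fields (Pr g h)     = pair (encode g) (encode h)
  fields (Mn g)       = encode g

  encodeV : ∀ {m n} → Vec (PR n) m → ℕ
  encodeV []       = 0
  encodeV (h ∷ hs) = pair (encode h) (encodeV hs)

mutual
  encode-injective : ∀ {n} {p q : PR n} → encode p ≡ encode q → p ≡ q
  encode-injective {p = p} {q} eq with pair-injective {tag p} {fields p} {tag q} {fields q} eq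
  ... | tag≡ , fields≡ = fields-injective p q tag≡ fields≡

  -- Matching on the equality of tags rules out all pairs of distinct constructors.
  fields-injective : ∀ {n} (p q : PR n) → tag p ≡ tag q → fields p ≡ fields q → p ≡ q
  fields-injective Z         Z           refl _  = refl
  fields-injective S         S           refl _  = refl
  fields-injective (P i)     (P j)       refl eq = cong P (toℕ-injective eq)
  fields-injective (Cn {m} g hs) (Cn {m′} g′ hs′) refl eq
    with pair-injective {m} {pair (encode g) (encodeV hs)} {m′} {pair (encode g′) (encodeV hs′)} eq
  ... | refl , eq′ with pair-injective {encode g} {encodeV hs} {encode g′} {encodeV hs′} eq′
  ... | g≡ , hs≡ = cong₂ Cn (encode-injective g≡) (encodeV-injective hs≡)
  fields-injective (Pr g h)  (Pr g′ h′)  refl eq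
    with pair-injective {encode g} {encode h} {encode g′} {encode h′} eq
  ... | g≡ , h≡ = cong₂ Pr (encode-injective g≡) (encode-injective h≡)
  fields-injective (Mn g)    (Mn g′)     refl eq = cong Mn (encode-injective eq)

  encodeV-injective : ∀ {m n} {hs hs′ : Vec (PR n) m} → encodeV hs ≡ encodeV hs′ → hs ≡ hs′
  encodeV-injective {hs = []}    {[]}      _  = refl
  encodeV-injective {hs = h ∷ hs} {h′ ∷ hs′} eq
    with pair-injective {encode h} {encodeV hs} {encode h′} {encodeV hs′} eq
  ... | h≡ , hs≡ = cong₂ _∷_ (encode-injective h≡) (encodeV-injective hs≡)

⊆*-∩ : ∀ {C X Y : Pred} → C ⊆* X → C ⊆* Y → C ⊆* (λ x → X x × Y x)
⊆*-∩ (b , X⊇) (b′ , Y⊇) =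
  b ⊔ b′ , λ x b⊔b′≤x cx → X⊇ x (≤-trans (m≤m⊔n b b′) b⊔b′≤x) cx ,
                           Y⊇ x (≤-trans (m≤n⊔m b b′) b⊔b′≤x) cx

ConstantBeyond : Pred → ℕ → Pred → Set
ConstantBeyond C b X = ∀ x x′ → b ≤ x → b ≤ x′ → C x → C x′ → X x → X x′

ConstantBeyond-mono : ∀ {C X b b′} → b ≤ b′ → ConstantBeyond C b X → ConstantBeyond C b′ X
ConstantBeyond-mono b≤b′ const x x′ b′≤x b′≤x′ = const x x′ (≤-trans b≤b′ b′≤x) (≤-trans b≤b′ b′≤x′)

cohesive-constant : ∀ {C} → Cohesive C → ∀ e → Σ ℕ λ b → ConstantBeyond C b (W e)
cohesive-constant (_ , split) e with split e
... | inj₁ (b , C⊆*W) = b , λ x x′ _ b≤x′ _ cx′ _ → C⊆*W x′ b≤x′ cx′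
... | inj₂ (b , C∩W<b) =
  b , λ x _ b≤x _ cx _ wx → ⊥-elim (<-irrefl refl (≤-<-trans b≤x (C∩W<b x (cx , wx))))

ConstantBeyond-all : ∀ {I : Set} {C} (X : I → Pred) → (∀ i → Σ ℕ λ b → ConstantBeyond C b (X i)) →
                     (is : List I) → Σ ℕ λ b → ∀ {i} → i ∈ is → ConstantBeyond C b (X i)
ConstantBeyond-all X const []       = 0 , λ ()
ConstantBeyond-all X const (i ∷ is) =
  let (b , c) = const i
      (b′ , cs) = ConstantBeyond-all X const is
  in b ⊔ b′ , λ { (here refl) → ConstantBeyond-mono (m≤m⊔n b b′) c
                ; (there i∈) → ConstantBeyond-mono (m≤n⊔m b b′) (cs i∈) }

⊆*-witness : ∀ {C X : Pred} → Infinite C → C ⊆* X → Σ ℕ λ x → C x × X x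
⊆*-witness infinite (b , C⊆X) = let (x , b≤x , cx) = infinite b in x , cx , C⊆X x b≤x cx

supremum : ∀ {r} → (Fin r → ℕ) → ℕ
supremum {zero}  f = 0
supremum {suc r} f = f zero ⊔ supremum (λ l → f (suc l))

≤-supremum : ∀ {r} (f : Fin r → ℕ) l → f l ≤ supremum f
≤-supremum f zero    = m≤m⊔n (f zero) _
≤-supremum f (suc l) = ≤-trans (≤-supremum (λ l → f (suc l)) l) (m≤n⊔m (f zero) _)

module Terms {L : Language} (𝒜 : CompStructure L) where

  open Language L
  open CompStructure 𝒜

  A : Structure L
  A = struct
  module A = Structure A

  Elem : Set
  Elem = Σ ℕ Dom

  raw : ∀ {k} → Vec Elem k → Vec ℕ k
  raw = map proj₁

  Aut : Set
  Aut = A ≅ A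

  fun-eval : ∀ i (xs : Vec Elem (funAr i)) → Eval (funCode i) (raw xs) (proj₁ (A.fun i xs))
  fun-eval i xs = proj₂ (funTotal i (raw xs) _)

  fun-resp : ∀ i {xs ys : Vec Elem (funAr i)} → raw xs ≡ raw ys → proj₁ (A.fun i xs) ≡ proj₁ (A.fun i ys)
  fun-resp i {xs} {ys} eq =
    Eval-deterministic (subst (λ zs → Eval (funCode i) zs _) eq (fun-eval i xs)) (fun-eval i ys)

  data Term (n : ℕ) : Set where
    var : Fin n → Term n
    cst : Fin nCon → Term n
    app : (i : Fin nFun) → Vec (Term n) (funAr i) → Term n

  mutual
    ⟦_⟧ : ∀ {n} → Term n → Vec Elem n → Elem
    ⟦ var i ⟧    v = lookup v i
    ⟦ cst c ⟧    v = A.con c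
    ⟦ app i ts ⟧ v = A.fun i (⟦ ts ⟧* v)

    ⟦_⟧* : ∀ {n k} → Vec (Term n) k → Vec Elem n → Vec Elem k
    ⟦ [] ⟧*     v = []
    ⟦ t ∷ ts ⟧* v = ⟦ t ⟧ v ∷ ⟦ ts ⟧* v

  val : ∀ {n} → Term n → Vec Elem n → ℕ
  val t v = proj₁ (⟦ t ⟧ v)

  mutual
    termP : ∀ {n} → Term n → PR n
    termP (var i)    = P i
    termP (cst c)    = Cn (constCode (conVal c)) (Z ∷ [])
    termP (app i ts) = Cn (funCode i) (termsP ts)

    termsP : ∀ {n k} → Vec (Term n) k → Vec (PR n) k
    termsP []       = []
    termsP (t ∷ ts) = termP t ∷ termsP ts

  mutual
    termP-eval : ∀ {n} (t : Term n) v → Eval (termP t) (raw v) (val t v)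
    termP-eval (var i)    v = subst (Eval (P i) (raw v)) (lookup-map i proj₁ v) evP
    termP-eval (cst c)    v = evCn (evZ ∷ []) (constCode-ev (conVal c) 0)
    termP-eval (app i ts) v = evCn (termsP-eval ts v) (fun-eval i (⟦ ts ⟧* v))

    termsP-eval : ∀ {n k} (ts : Vec (Term n) k) v → EvalV (termsP ts) (raw v) (raw (⟦ ts ⟧* v))
    termsP-eval []       v = []
    termsP-eval (t ∷ ts) v = termP-eval t v ∷ termsP-eval ts v

  -- By determinism of the program computing t, which only sees raw v.
  val-resp : ∀ {n} (t : Term n) {v w} → raw v ≡ raw w → val t v ≡ val t w
  val-resp t {v} {w} eq =
    Eval-deterministic (subst (λ zs → Eval (termP t) zs (val t v)) eq (termP-eval t v)) (termP-eval t w)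

  vals-resp : ∀ {n k} (ts : Vec (Term n) k) {v w} → raw v ≡ raw w → raw (⟦ ts ⟧* v) ≡ raw (⟦ ts ⟧* w)
  vals-resp ts {v} {w} eq =
    EvalV-deterministic (subst (λ zs → EvalV (termsP ts) zs _) eq (termsP-eval ts v)) (termsP-eval ts w)

  data Depth≤ {n} : ℕ → Term n → Set where
    var : ∀ {d i} → Depth≤ d (var i)
    cst : ∀ {d c} → Depth≤ d (cst c)
    app : ∀ {d i ts} → All (Depth≤ d) ts → Depth≤ (suc d) (app i ts)

  mutual
    Depth≤-mono : ∀ {n d d′} {t : Term n} → d ≤ d′ → Depth≤ d t → Depth≤ d′ t
    Depth≤-mono _         var      = var
    Depth≤-mono _         cst      = cst
    Depth≤-mono (s≤s d≤d′) (app ds) = app (Depth≤*-mono d≤d′ ds)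

    Depth≤*-mono : ∀ {n d d′ k} {ts : Vec (Term n) k} → d ≤ d′ → All (Depth≤ d) ts → All (Depth≤ d′) ts
    Depth≤*-mono _    []       = []
    Depth≤*-mono d≤d′ (d ∷ ds) = Depth≤-mono d≤d′ d ∷ Depth≤*-mono d≤d′ ds

  data Atom (n : ℕ) : Set where
    _≐_ : Term n → Term n → Atom n
    rel : (r : Fin nRel) → Vec (Term n) (relAr r) → Atom n

  Holds : ∀ {n} → Atom n → Vec Elem n → Set
  Holds (t ≐ s)    v = val t v ≡ val s v
  Holds (rel r ts) v = A.rel r (⟦ ts ⟧* v)

  AtomDepth≤ : ∀ {n} → ℕ → Atom n → Set
  AtomDepth≤ d (t ≐ s)    = Depth≤ d t × Depth≤ d s
  AtomDepth≤ d (rel r ts) = All (Depth≤ d) ts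

  rel-resp : ∀ r {xs ys : Vec Elem (relAr r)} → raw xs ≡ raw ys → A.rel r xs ⇔ A.rel r ys
  rel-resp r eq = mk⇔ (subst (λ zs → Eval (relCode r) zs 1) eq) (subst (λ zs → Eval (relCode r) zs 1) (sym eq))

  Holds-resp : ∀ {n} (α : Atom n) {v w} → raw v ≡ raw w → Holds α v ⇔ Holds α w
  Holds-resp (t ≐ s) eq =
    mk⇔ (λ h → trans (sym (val-resp t eq)) (trans h (val-resp s eq)))
        (λ h → trans (val-resp t eq) (trans h (sym (val-resp s eq))))
  Holds-resp (rel r ts) eq = rel-resp r (vals-resp ts eq)

  atomP : ∀ {n} → Atom n → PR n
  atomP (t ≐ s)    = Cn distP (termP t ∷ termP s ∷ [])
  atomP (rel r ts) = Cn (notP (relCode r)) (termsP ts)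

  atomP-ZeroIff : ∀ {n} (α : Atom n) v → ZeroIff (atomP α) (raw v) (Holds α v)
  atomP-ZeroIff (t ≐ s)    v = distP-ZeroIff (termP-eval t v) (termP-eval s v)
  atomP-ZeroIff (rel r ts) v =
    Cn-ZeroIff (termsP-eval ts v) (characteristic-ZeroIff (relTotal r _ (allDom (⟦ ts ⟧* v))))
    where
    allDom : ∀ {k} (xs : Vec Elem k) → All Dom (raw xs)
    allDom []             = []
    allDom ((_ , d) ∷ xs) = d ∷ allDom xs

  Holds? : ∀ {n} (α : Atom n) v → Dec (Holds α v)
  Holds? α v = ZeroIff-dec (atomP-ZeroIff α v)

  SameAtomicType : ∀ {n} → Vec Elem n → Vec Elem n → Set
  SameAtomicType v w = ∀ α → Holds α v ⇔ Holds α w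

  record SameOrbit {n} (v w : Vec Elem n) : Set where
    constructor _,_
    field
      σ     : Aut
      moves : ∀ i → proj₁ (Iso.h σ (lookup v i)) ≡ proj₁ (lookup w i)

  pointwise⇒raw : ∀ {n} (f : Elem → Elem) {v w : Vec Elem n} →
                  (∀ i → proj₁ (f (lookup v i)) ≡ proj₁ (lookup w i)) → raw (map f v) ≡ raw w
  pointwise⇒raw f {[]}    {[]}    _  = refl
  pointwise⇒raw f {_ ∷ _} {_ ∷ _} eq = cong₂ _∷_ (eq zero) (pointwise⇒raw f (λ i → eq (suc i)))

  module _ (σ : Aut) where
    open Iso σ

    mutual
      h-val : ∀ {n} (t : Term n) v → proj₁ (h (⟦ t ⟧ v)) ≡ val t (map h v)
      h-val (var i)    v = cong proj₁ (sym (lookup-map i h v))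
      h-val (cst c)    v = h-con c
      h-val (app i ts) v = trans (h-fun i (⟦ ts ⟧* v)) (fun-resp i (h-vals ts v))

      h-vals : ∀ {n k} (ts : Vec (Term n) k) v → raw (map h (⟦ ts ⟧* v)) ≡ raw (⟦ ts ⟧* (map h v))
      h-vals []       v = refl
      h-vals (t ∷ ts) v = cong₂ _∷_ (h-val t v) (h-vals ts v)

    Aut-Holds : ∀ {n} (α : Atom n) v → Holds α v ⇔ Holds α (map h v)
    Aut-Holds (t ≐ s) v =
      mk⇔ (λ eq → trans (sym (h-val t v)) (trans (h-cong eq) (h-val s v)))
          (λ eq → h-inj (trans (h-val t v) (trans eq (sym (h-val s v)))))
    Aut-Holds (rel r ts) v = ⇔.trans (h-rel r (⟦ ts ⟧* v)) (rel-resp r (h-vals ts v))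

  SameOrbit⇒SameAtomicType : ∀ {n} {v w : Vec Elem n} → SameOrbit v w → SameAtomicType v w
  SameOrbit⇒SameAtomicType (σ , eq) α = ⇔.trans (Aut-Holds σ α _) (Holds-resp α (pointwise⇒raw (Iso.h σ) eq))

module Homogeneity {L : Language} (𝒜 : CompStructure L) where

  open Language L
  open CompStructure 𝒜
  open Terms 𝒜

  _≈_ : Elem → Elem → Set
  x ≈ y = proj₁ x ≡ proj₁ y

  member-index : ∀ {n} {Q : Elem → Set} (v : Vec Elem n) → Any Q (toList v) → Σ (Fin n) λ i → Q (lookup v i)
  member-index (_ ∷ _) (here q)  = zero , q
  member-index (_ ∷ v) (there m) = let (i , q) = member-index v m in suc i , q

  lookup-member : ∀ {n} (v : Vec Elem n) i → Any (_≈ lookup v i) (toList v)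
  lookup-member (_ ∷ _) zero    = here refl
  lookup-member (_ ∷ v) (suc i) = there (lookup-member v i)

  member-index-lookup : ∀ {n} (v : Vec Elem n) i → proj₁ (member-index v (lookup-member v i)) ≡ i
  member-index-lookup (_ ∷ _) zero    = refl
  member-index-lookup (_ ∷ v) (suc i) = cong suc (member-index-lookup v i)

  module Naming {n} (v : Vec Elem n) where

    Generated : Elem → Set
    Generated = Gen A (toList v)

    mutual
      name : ∀ {x} → Generated x → Term n
      name (gen-base m)    = var (proj₁ (member-index v m))
      name (gen-con c)     = cst c
      name (gen-fun i gs)  = app i (names gs)
      name (gen-resp g _)  = name g

      names : ∀ {k} {xs : Vec Elem k} → All Generated xs → Vec (Term n) k
      names []       = []
      names (g ∷ gs) = name g ∷ names gs

    mutual
      name-val : ∀ {x} (g : Generated x) → val (name g) v ≡ proj₁ x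
      name-val (gen-base m)   = proj₂ (member-index v m)
      name-val (gen-con c)    = refl
      name-val (gen-fun i gs) = fun-resp i (names-val gs)
      name-val (gen-resp g e) = trans (name-val g) e

      names-val : ∀ {k} {xs : Vec Elem k} (gs : All Generated xs) → raw (⟦ names gs ⟧* v) ≡ raw xs
      names-val []       = refl
      names-val (g ∷ gs) = cong₂ _∷_ (name-val g) (names-val gs)

    mutual
      generated : (t : Term n) → Generated (⟦ t ⟧ v)
      generated (var i)    = gen-base (lookup-member v i)
      generated (cst c)    = gen-con c
      generated (app i ts) = gen-fun i (generated* ts)

      generated* : ∀ {k} (ts : Vec (Term n) k) → All Generated (⟦ ts ⟧* v)
      generated* []       = []
      generated* (t ∷ ts) = generated t ∷ generated* ts

  -- Send the element named by t at v to the element named by t at w.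
  SameAtomicType⇒≅ : ∀ {n} {v w : Vec Elem n} → SameAtomicType v w → Sub A (toList v) ≅ Sub A (toList w)
  SameAtomicType⇒≅ {n} {v} {w} same = record
    { h      = h
    ; h-cong = λ { {_ , g} {_ , g′} e → transfer (V.name g) (V.name g′) (name-eq g g′ e) }
    ; h-inj  = λ { {_ , g} {_ , g′} e →
                 trans (sym (V.name-val g))
                       (trans (Equivalence.from (same (V.name g ≐ V.name g′)) e) (V.name-val g′)) }
    ; h-surj = λ { (_ , g′) → let t = W.name g′ in
                 (⟦ t ⟧ v , V.generated t) ,
                 trans (transfer (V.name (V.generated t)) t (V.name-val (V.generated t))) (W.name-val g′) }
    ; h-rel  = λ r xs → ⇔.trans (rel-resp r (sym (named-at-v xs)))
                                (⇔.trans (same (rel r (namesOf xs))) (rel-resp r (named-at-w xs)))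
    ; h-fun  = λ i xs → fun-resp i (names-at-w xs _)
    ; h-con  = λ c → refl
    }
    where
    module V = Naming v
    module W = Naming w

    h : Σ Elem V.Generated → Σ Elem W.Generated
    h (_ , g) = ⟦ V.name g ⟧ w , W.generated (V.name g)

    transfer : ∀ t s → val t v ≡ val s v → val t w ≡ val s w
    transfer t s = Equivalence.to (same (t ≐ s))

    name-eq : ∀ {x y} (g : V.Generated x) (g′ : V.Generated y) → x ≈ y → val (V.name g) v ≡ val (V.name g′) v
    name-eq g g′ e = trans (V.name-val g) (trans e (sym (V.name-val g′)))

    namesOf : ∀ {k} → Vec (Σ Elem V.Generated) k → Vec (Term n) k
    namesOf = map (λ x → V.name (proj₂ x))

    named-at-v : ∀ {k} (xs : Vec (Σ Elem V.Generated) k) → raw (⟦ namesOf xs ⟧* v) ≡ raw (map proj₁ xs)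
    named-at-v []             = refl
    named-at-v ((_ , g) ∷ xs) = cong₂ _∷_ (V.name-val g) (named-at-v xs)

    named-at-w : ∀ {k} (xs : Vec (Σ Elem V.Generated) k) → raw (⟦ namesOf xs ⟧* w) ≡ raw (map proj₁ (map h xs))
    named-at-w []       = refl
    named-at-w (_ ∷ xs) = cong₂ _∷_ refl (named-at-w xs)

    names-at-w : ∀ {k} (xs : Vec (Σ Elem V.Generated) k) (gs : All V.Generated (map proj₁ xs)) →
                 raw (⟦ V.names gs ⟧* w) ≡ raw (map proj₁ (map h xs))
    names-at-w []             []        = refl
    names-at-w ((_ , g) ∷ xs) (g′ ∷ gs) =
      cong₂ _∷_ (transfer (V.name g′) (V.name g) (name-eq g′ g refl)) (names-at-w xs gs)

  SameAtomicType⇒SameOrbit : Ultrahomogeneous A → ∀ {n} {v w : Vec Elem n} → SameAtomicType v w → SameOrbit v w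
  SameAtomicType⇒SameOrbit uh {v = v} {w} same =
    let (σ , extends) = uh (toList v) (toList w) (SameAtomicType⇒≅ same) in
    σ , λ i → trans (extends (lookup v i , gen-base (lookup-member v i)))
                    (cong (λ j → proj₁ (lookup w j)) (member-index-lookup v i))

module LocalFiniteness {L : Language} (𝒜 : CompStructure L) (em : ExcludedMiddle 0ℓ)
                       (ulf : UniformlyLocallyFinite (CompStructure.struct 𝒜)) where

  open Language L
  open CompStructure 𝒜
  open Terms 𝒜
  open Homogeneity 𝒜 using (_≈_; module Naming)

  bound : ℕ → ℕ
  bound = proj₁ ulf

  module _ {n} (v : Vec Elem n) where

    Closed : ℕ → Set
    Closed d = ∀ i (ts : Vec (Term n) (funAr i)) → All (Depth≤ d) ts →
               Σ (Term n) λ s → Depth≤ d s × val (app i ts) v ≡ val s v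

    Escape : ℕ → Set
    Escape d = Σ (Fin nFun) λ i → Σ (Vec (Term n) (funAr i)) λ ts → All (Depth≤ d) ts ×
               (∀ s → Depth≤ d s → val (app i ts) v ≢ val s v)

    ¬Closed⇒Escape : ∀ {d} → ¬ Closed d → Escape d
    ¬Closed⇒Escape {d} ¬closed with em {Escape d}
    ... | yes escape = escape
    ... | no ¬escape = ⊥-elim (¬closed closed)
      where
      closed : Closed d
      closed i ts ds with em {Σ (Term n) λ s → Depth≤ d s × val (app i ts) v ≡ val s v}
      ... | yes s = s
      ... | no ¬s = ⊥-elim (¬escape (i , ts , ds , λ s ds e → ¬s (s , ds , e)))

    Named : ℕ → Elem → Set
    Named d y = Σ (Term n) λ t → Depth≤ d t × proj₁ y ≡ val t v

    -- Each failure of closure at depth d < m produces a value not named below depth d + 1.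
    distinct-values : ∀ m → (∀ d → d < m → ¬ Closed d) →
      Σ (List Elem) λ ys → length ys ≡ m × ListAll.All (Named m) ys × AllPairs (λ a b → ¬ (a ≈ b)) ys
    distinct-values zero    _     = [] , refl , ListAll.[] , []
    distinct-values (suc m) ¬closed =
      let (ys , length≡ , named , distinct) = distinct-values m (λ d d<m → ¬closed d (≤-trans d<m (n≤1+n m)))
          (i , ts , ds , new) = ¬Closed⇒Escape (¬closed m ≤-refl)
      in ⟦ app i ts ⟧ v ∷ ys , cong suc length≡ ,
         (app i ts , app ds , refl) ListAll.∷
           ListAll.map (λ (t , dt , e) → t , Depth≤-mono (n≤1+n m) dt , e) named ,
         ListAll.map (λ (t , dt , e) eq → new t dt (trans eq e)) named ∷ distinct

    -- Otherwise bound n + 1 distinct elements would be generated by the n entries of v.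
    closed-depth : Σ ℕ λ d → d ≤ bound n × Closed d
    closed-depth with em {Σ ℕ λ d → d ≤ bound n × Closed d}
    ... | yes found = found
    ... | no none =
      let (ys , length≡ , named , distinct) =
            distinct-values (suc (bound n)) (λ d d<1+b closed → none (d , ≤-pred d<1+b , closed))
          generated = ListAll.map (λ (t , _ , e) → gen-resp (Naming.generated v t) (sym e)) named
          too-many = proj₂ ulf n (toList v) (≤-reflexive (length-toList v)) ys generated distinct
      in ⊥-elim (<-irrefl refl (subst (_≤ bound n) length≡ too-many))

  SameAtomicTypeUpTo : ∀ {n} → ℕ → Vec Elem n → Vec Elem n → Set
  SameAtomicTypeUpTo D v w = ∀ α → AtomDepth≤ D α → Holds α v ⇔ Holds α w

  -- Below a closed depth d every term has the value of a term of depth ≤ d, at v and at w alike: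
  -- the replacements are justified at w by atoms of depth ≤ d + 1.
  module _ {n} {v w : Vec Elem n} (same : SameAtomicTypeUpTo (suc (bound n)) v w) where

    private
      d : ℕ
      d = proj₁ (closed-depth v)

      d≤b : d ≤ bound n
      d≤b = proj₁ (proj₂ (closed-depth v))

      closed : Closed v d
      closed = proj₂ (proj₂ (closed-depth v))

      lift : ∀ {t : Term n} → Depth≤ d t → Depth≤ (suc (bound n)) t
      lift = Depth≤-mono (m≤n⇒m≤1+n d≤b)

    mutual
      shallow : (t : Term n) → Σ (Term n) λ s → Depth≤ d s × val t v ≡ val s v × val t w ≡ val s w
      shallow (var i)    = var i , var , refl , refl
      shallow (cst c)    = cst c , cst , refl , refl
      shallow (app i ts) =
        let (ss , dss , ev , ew) = shallow* ts
            (s , ds , e) = closed i ss dss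
            app≐s = same (app i ss ≐ s) (Depth≤-mono (s≤s d≤b) (app dss) , lift ds)
        in s , ds , trans (fun-resp i ev) e , trans (fun-resp i ew) (Equivalence.to app≐s e)

      shallow* : ∀ {k} (ts : Vec (Term n) k) → Σ (Vec (Term n) k) λ ss → All (Depth≤ d) ss ×
                 raw (⟦ ts ⟧* v) ≡ raw (⟦ ss ⟧* v) × raw (⟦ ts ⟧* w) ≡ raw (⟦ ss ⟧* w)
      shallow* []       = [] , [] , refl , refl
      shallow* (t ∷ ts) =
        let (s , ds , ev , ew) = shallow t
            (ss , dss , evs , ews) = shallow* ts
        in s ∷ ss , ds ∷ dss , cong₂ _∷_ ev evs , cong₂ _∷_ ew ews

    SameAtomicTypeUpTo⇒SameAtomicType : SameAtomicType v w
    SameAtomicTypeUpTo⇒SameAtomicType (t ≐ s) =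
      let (t′ , dt′ , tv , tw) = shallow t
          (s′ , ds′ , sv , sw) = shallow s
          t′≐s′ = same (t′ ≐ s′) (lift dt′ , lift ds′)
      in mk⇔ (λ e → trans tw (trans (Equivalence.to t′≐s′ (trans (sym tv) (trans e sv))) (sym sw)))
             (λ e → trans tv (trans (Equivalence.from t′≐s′ (trans (sym tw) (trans e sw))) (sym sv)))
    SameAtomicTypeUpTo⇒SameAtomicType (rel r ts) =
      let (ss , dss , ev , ew) = shallow* ts
          r≡ = same (rel r ss) (Depth≤*-mono (m≤n⇒m≤1+n d≤b) dss)
      in ⇔.trans (rel-resp r ev) (⇔.trans r≡ (rel-resp r (sym ew)))

vectors : ∀ {X : Set} k → List X → List (Vec X k)
vectors zero    xs = [] ∷ []
vectors (suc k) xs = cartesianProductWith _∷_ xs (vectors k xs)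

∈-vectors : ∀ {X : Set} {k} {xs : List X} {v : Vec X k} → All (_∈ xs) v → v ∈ vectors k xs
∈-vectors []         = here refl
∈-vectors (x∈ ∷ v∈) = ∈-cartesianProductWith⁺ _∷_ x∈ (∈-vectors v∈)

module AtomEnumeration {L : Language} (𝒜 : CompStructure L) where

  open Language L
  open Terms 𝒜

  module _ {n : ℕ} where

    mutual
      terms : ℕ → List (Term n)
      terms d = List.map var (allFin n) ++ List.map cst (allFin nCon) ++ applications d

      applications : ℕ → List (Term n)
      applications zero    = []
      applications (suc d) = concatMap (λ i → List.map (app i) (vectors (funAr i) (terms d))) (allFin nFun)

    mutual
      ∈-terms : ∀ {d} {t : Term n} → Depth≤ d t → t ∈ terms d
      ∈-terms (var {i = i}) = ∈-++⁺ˡ (∈-map⁺ var (∈-allFin i))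
      ∈-terms (cst {c = c}) = ∈-++⁺ʳ (List.map var (allFin n)) (∈-++⁺ˡ (∈-map⁺ cst (∈-allFin c)))
      ∈-terms {suc d} (app {i = i} ds) =
        ∈-++⁺ʳ (List.map var (allFin n)) (∈-++⁺ʳ (List.map cst (allFin nCon))
          (∈-concatMap⁺ (λ i → List.map (app i) (vectors (funAr i) (terms d)))
            (lose (∈-allFin i) (∈-map⁺ (app i) (∈-vectors (∈-terms* ds))))))

      ∈-terms* : ∀ {d k} {ts : Vec (Term n) k} → All (Depth≤ d) ts → All (_∈ terms d) ts
      ∈-terms* []       = []
      ∈-terms* (d ∷ ds) = ∈-terms d ∷ ∈-terms* ds

    atoms : ℕ → List (Atom n)
    atoms d = cartesianProductWith _≐_ (terms d) (terms d) ++
              concatMap (λ r → List.map (rel r) (vectors (relAr r) (terms d))) (allFin nRel)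

    ∈-atoms : ∀ {d} {α : Atom n} → AtomDepth≤ d α → α ∈ atoms d
    ∈-atoms {d} {t ≐ s}    (dt , ds) = ∈-++⁺ˡ (∈-cartesianProductWith⁺ _≐_ (∈-terms dt) (∈-terms ds))
    ∈-atoms {d} {rel r ts} dts       =
      ∈-++⁺ʳ (cartesianProductWith _≐_ (terms d) (terms d))
        (∈-concatMap⁺ (λ r → List.map (rel r) (vectors (relAr r) (terms d)))
          (lose (∈-allFin r) (∈-map⁺ (rel r) (∈-vectors (∈-terms* dts)))))

module OrbitTest {L : Language} (𝒜 : CompStructure L) (em : ExcludedMiddle 0ℓ)
                 (ulf : UniformlyLocallyFinite (CompStructure.struct 𝒜))
                 (uh : Ultrahomogeneous (CompStructure.struct 𝒜)) where

  open Terms 𝒜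
  open AtomEnumeration 𝒜
  open LocalFiniteness 𝒜 em ulf
  open Homogeneity 𝒜 using (SameAtomicType⇒SameOrbit)

  Agree : ∀ {n} → Vec Elem n → Vec Elem n → List (Atom n) → Set
  Agree u w = ListAll.All (λ α → Holds α u ⇔ Holds α w)

  agreeP : ∀ {n} → Vec Elem n → Atom n → PR n
  agreeP u α with Holds? α u
  ... | yes _ = atomP α
  ... | no  _ = notP (atomP α)

  agreeP-ZeroIff : ∀ {n} (u : Vec Elem n) α w → ZeroIff (agreeP u α) (raw w) (Holds α u ⇔ Holds α w)
  agreeP-ZeroIff u α w with Holds? α u
  ... | yes hu = ZeroIff-resp (mk⇔ (λ hw → mk⇔ (λ _ → hw) (λ _ → hu)) (λ e → Equivalence.to e hu))
                              (atomP-ZeroIff α w)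
  ... | no ¬hu = ZeroIff-resp (mk⇔ (λ ¬hw → mk⇔ (λ hu → ⊥-elim (¬hu hu)) (λ hw → ⊥-elim (¬hw hw)))
                                   (λ e hw → ¬hu (Equivalence.from e hw)))
                              (notP-ZeroIff (atomP-ZeroIff α w))

  agreeAllP : ∀ {n} → Vec Elem n → List (Atom n) → PR n
  agreeAllP u []       = Z
  agreeAllP u (α ∷ αs) = Cn addP (agreeP u α ∷ agreeAllP u αs ∷ [])

  agreeAllP-ZeroIff : ∀ {n} (u : Vec Elem n) αs w → ZeroIff (agreeAllP u αs) (raw w) (Agree u w αs)
  agreeAllP-ZeroIff u []       w = ZeroIff-resp (mk⇔ (λ _ → ListAll.[]) (λ _ → tt)) Z-ZeroIff
  agreeAllP-ZeroIff u (α ∷ αs) w =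
    ZeroIff-resp (mk⇔ (λ (a , as) → a ListAll.∷ as) (λ { (a ListAll.∷ as) → a , as }))
                 (addP-ZeroIff (agreeP-ZeroIff u α w) (agreeAllP-ZeroIff u αs w))

  typeAtoms : ∀ n → List (Atom n)
  typeAtoms n = atoms (suc (bound n))

  Agree⇒SameOrbit : ∀ {n} {u w : Vec Elem n} → Agree u w (typeAtoms n) → SameOrbit u w
  Agree⇒SameOrbit agree =
    SameAtomicType⇒SameOrbit uh (SameAtomicTypeUpTo⇒SameAtomicType (λ α d → ListAll.lookup agree (∈-atoms d)))

  orbitP : ∀ {n} → Vec Elem n → PR n
  orbitP {n} u = agreeAllP u (typeAtoms n)

  orbitP-ZeroIff : ∀ {n} (u w : Vec Elem n) → ZeroIff (orbitP u) (raw w) (SameOrbit u w)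
  orbitP-ZeroIff u w =
    ZeroIff-resp (mk⇔ Agree⇒SameOrbit (λ o → ListAll.tabulate (λ {α} _ → SameOrbit⇒SameAtomicType o α)))
                 (agreeAllP-ZeroIff u _ w)

module BackAndForth {L : Language} (𝒜 : CompStructure L) (em : ExcludedMiddle 0ℓ)
                    (ulf : UniformlyLocallyFinite (CompStructure.struct 𝒜))
                    (uh : Ultrahomogeneous (CompStructure.struct 𝒜))
                    (C : Pred) (coh : Cohesive C) (a₀ : Σ ℕ (CompStructure.Dom 𝒜)) where

  open CompStructure 𝒜
  open Terms 𝒜
  open Homogeneity 𝒜 using (SameAtomicType⇒SameOrbit)
  open OrbitTest 𝒜 em ulf uh
  open CohesivePower 𝒜 C
  open PC

  record Conjugate {n} (x : ℕ) (fs : Vec PC n) (u : Vec Elem n) : Set where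
    constructor _,_
    field
      σ      : Aut
      values : ∀ i → code (lookup fs i) ⟨ x ⟩≃ proj₁ (Iso.h σ (lookup u i))

  Tracks : ∀ {n} → Vec PC n → Vec Elem n → Set
  Tracks fs u = C ⊆* λ x → Conjugate x fs u

  Conjugate-EvalV : ∀ {n x} {fs : Vec PC n} {u} ((σ , _) : Conjugate x fs u) →
                    EvalV (map code fs) (x ∷ []) (raw (map (Iso.h σ) u))
  Conjugate-EvalV {fs = []}    {[]}    _        = []
  Conjugate-EvalV {fs = _ ∷ _} {_ ∷ _} (σ , ev) = ev zero ∷ Conjugate-EvalV (σ , λ i → ev (suc i))

  extend : ∀ {n x} {fs : Vec PC n} {u a} ((σ , _) : Conjugate x fs u) (ψ : PC) (e : Elem) →
           code ψ ⟨ x ⟩≃ proj₁ e → SameOrbit (a ∷ u) (e ∷ map (Iso.h σ) u) →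
           Conjugate x (ψ ∷ fs) (a ∷ u)
  extend {u = u} (σ , ev) ψ e evψ (τ , moves) = τ , λ
    { zero    → subst (code ψ ⟨ _ ⟩≃_) (sym (moves zero)) evψ
    ; (suc i) → subst (_ ⟨ _ ⟩≃_) (sym (trans (moves (suc i)) (cong proj₁ (lookup-map i (Iso.h σ) u)))) (ev i)
    }

  image-orbit : ∀ {n} (σ : Aut) (a e : Elem) (u : Vec Elem n) →
                proj₁ (Iso.h σ a) ≡ proj₁ e → SameOrbit (a ∷ u) (e ∷ map (Iso.h σ) u)
  image-orbit σ a e u σa≡e = σ , λ { zero → σa≡e ; (suc i) → cong proj₁ (sym (lookup-map i (Iso.h σ) u)) }

  SameOrbit-trans : ∀ {n} {u v w : Vec Elem n} → SameOrbit u v → SameOrbit v w → SameOrbit u w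
  SameOrbit-trans uv vw = SameAtomicType⇒SameOrbit uh
    (λ α → ⇔.trans (SameOrbit⇒SameAtomicType uv α) (SameOrbit⇒SameAtomicType vw α))

  tracks-[] : Tracks [] []
  tracks-[] = 0 , λ _ _ _ → idAut , λ ()
    where
    idAut : Aut
    idAut = record
      { h = λ x → x ; h-cong = λ e → e ; h-inj = λ e → e ; h-surj = λ b → b , refl
      ; h-rel = λ r xs → rel-resp r (cong raw (sym (map-id xs)))
      ; h-fun = λ i xs → fun-resp i (cong raw (sym (map-id xs)))
      ; h-con = λ c → refl }

  sel : ℕ → Elem
  sel z with domTotal z
  ... | inj₁ _ = a₀
  ... | inj₂ d = z , d

  sel-id : ∀ {z} → Dom z → proj₁ (sel z) ≡ z
  sel-id {z} d with domTotal z
  ... | inj₁ ev₀ = ⊥-elim (0≢1+n (Eval-deterministic ev₀ d))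
  ... | inj₂ _   = refl

  -- On input (k , z) this returns c if k = 0 and z otherwise.
  guardP : ℕ → PR 2
  guardP c = Pr (constCode c) (P (suc (suc zero)))

  selP : PR 1
  selP = Cn (guardP (proj₁ a₀)) (domCode ∷ P zero ∷ [])

  selP-eval : ∀ z → Eval selP (z ∷ []) (proj₁ (sel z))
  selP-eval z with domTotal z
  ... | inj₁ ev₀ = evCn (ev₀ ∷ evP ∷ []) (evPr0 (constCode-ev _ z))
  ... | inj₂ ev₁ = evCn (ev₁ ∷ evP ∷ []) (evPrS (evPr0 (constCode-ev _ z)) evP)

  module Forth {n} (fs : Vec PC n) (u : Vec Elem n) (tracks : Tracks fs u) (a : Elem) where

    searchP : PR 2
    searchP = Cn (orbitP (a ∷ u)) (Cn selP (P zero ∷ []) ∷ map weaken (map code fs))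

    search : ∀ {x} ((σ , _) : Conjugate x fs u) →
             Σ ℕ λ y → Eval (Mn searchP) (x ∷ []) y × SameOrbit (a ∷ u) (sel y ∷ map (Iso.h σ) u)
    search {x} (σ , ev) =
      let (y , found) = Mn-complete total zero₀
      in y , found , Equivalence.to (ZeroIff-sound (test y) (Mn-zero found)) refl
      where
      test : ∀ z → ZeroIff searchP (z ∷ x ∷ []) (SameOrbit (a ∷ u) (sel z ∷ map (Iso.h σ) u))
      test z = Cn-ZeroIff (evCn (evP ∷ []) (selP-eval z) ∷ weaken-EvalV (Conjugate-EvalV (σ , ev)))
                          (orbitP-ZeroIff _ _)

      total : ∀ z → Σ ℕ (Eval searchP (z ∷ x ∷ []))
      total z = proj₁ (test z) , proj₁ (proj₂ (test z))

      zero₀ : Eval searchP (proj₁ (Iso.h σ a) ∷ x ∷ []) 0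
      zero₀ = let (_ , ev₀ , m≡0⇔) = test _ in
        subst (Eval _ _) (Equivalence.from m≡0⇔ (image-orbit σ a _ u (sym (sel-id (proj₂ (Iso.h σ a)))))) ev₀

    ψcode : PR 1
    ψcode = Cn selP (Mn searchP ∷ [])

    ψ : PC
    ψ = pc ψcode
           (λ { x y (evCn (_ ∷ []) ev) → subst Dom (Eval-deterministic (selP-eval _) ev) (proj₂ (sel _)) })
           (proj₁ tracks , λ x b≤x cx →
             let (y , found , _) = search (proj₂ tracks x b≤x cx) in _ , evCn (found ∷ []) (selP-eval y))

    tracks-ψ : Tracks (ψ ∷ fs) (a ∷ u)
    tracks-ψ = proj₁ tracks , λ x b≤x cx →
      let c = proj₂ tracks x b≤x cx
          (y , found , orbit) = search c
      in extend c ψ (sel y) (evCn (found ∷ []) (selP-eval y)) orbit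

  -- By cohesiveness, beyond some bound every atom of the relevant finite list is either true at
  -- (ψ ∷ fs)(x) for all x ∈ C or false for all of them; a takes the type seen at one such x₀.
  module Back {n} (fs : Vec PC n) (u : Vec Elem n) (tracks : Tracks fs u) (ψ : PC) where

    Defined : ℕ → Set
    Defined x = Conjugate x fs u × W (code ψ) x

    value : ∀ {x} → Defined x → Vec Elem (suc n)
    value {x} ((σ , _) , (y , ev)) = (y , vals ψ x y ev) ∷ map (Iso.h σ) u

    value-EvalV : ∀ {x} (d : Defined x) → EvalV (map code (ψ ∷ fs)) (x ∷ []) (raw (value d))
    value-EvalV (c , (_ , evψ)) = evψ ∷ Conjugate-EvalV c

    atomSet : Atom (suc n) → PR 1
    atomSet α = zeroSet (Cn (atomP α) (map code (ψ ∷ fs)))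

    W-atomSet : ∀ α {x} (d : Defined x) → W (atomSet α) x ⇔ Holds α (value d)
    W-atomSet α d = W-zeroSet (Cn-ZeroIff (value-EvalV d) (atomP-ZeroIff α (value d)))

    defined : C ⊆* Defined
    defined = ⊆*-∩ tracks (dom ψ)

    constant : Σ ℕ λ b → ∀ {α} → α ∈ typeAtoms (suc n) → ConstantBeyond C b (W (atomSet α))
    constant = ConstantBeyond-all (λ α → W (atomSet α)) (λ α → cohesive-constant coh (atomSet α))
                                  (typeAtoms (suc n))

    B : ℕ
    B = proj₁ defined ⊔ proj₁ constant

    defined-beyond : ∀ {x} → B ≤ x → C x → Defined x
    defined-beyond B≤x cx = proj₂ defined _ (≤-trans (m≤m⊔n (proj₁ defined) (proj₁ constant)) B≤x) cx

    x₀ : ℕ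
    x₀ = proj₁ (proj₁ coh B)

    B≤x₀ : B ≤ x₀
    B≤x₀ = proj₁ (proj₂ (proj₁ coh B))

    cx₀ : C x₀
    cx₀ = proj₂ (proj₂ (proj₁ coh B))

    d₀ : Defined x₀
    d₀ = defined-beyond B≤x₀ cx₀

    σ₀ : Aut
    σ₀ = Conjugate.σ (proj₁ d₀)

    e₀ : Elem
    e₀ = proj₁ (proj₂ d₀) , vals ψ x₀ _ (proj₂ (proj₂ d₀))

    a : Elem
    a = proj₁ (Iso.h-surj σ₀ e₀)

    W-atomSet-constant : ∀ {x x′} → B ≤ x → B ≤ x′ → C x → C x′ →
                         ∀ {α} → α ∈ typeAtoms (suc n) → W (atomSet α) x → W (atomSet α) x′
    W-atomSet-constant B≤x B≤x′ cx cx′ α∈ =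
      proj₂ constant α∈ _ _ (≤-trans (m≤n⊔m (proj₁ defined) _) B≤x)
                            (≤-trans (m≤n⊔m (proj₁ defined) _) B≤x′) cx cx′

    agree-beyond : ∀ {x} (B≤x : B ≤ x) (cx : C x) →
                   Agree (value d₀) (value (defined-beyond B≤x cx)) (typeAtoms (suc n))
    agree-beyond B≤x cx = ListAll.tabulate λ {α} α∈ → mk⇔
      (λ h → Equivalence.to (W-atomSet α d)
               (W-atomSet-constant B≤x₀ B≤x cx₀ cx α∈ (Equivalence.from (W-atomSet α d₀) h)))
      (λ h → Equivalence.to (W-atomSet α d₀)
               (W-atomSet-constant B≤x B≤x₀ cx cx₀ α∈ (Equivalence.from (W-atomSet α d) h)))
      where d = defined-beyond B≤x cx

    tracks-ψ : Tracks (ψ ∷ fs) (a ∷ u)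
    tracks-ψ = B , λ x B≤x cx →
      let (c , (y , evψ)) = defined-beyond B≤x cx
      in extend c ψ (y , vals ψ x y evψ) evψ
           (SameOrbit-trans (image-orbit σ₀ a e₀ u (proj₂ (Iso.h-surj σ₀ e₀)))
                            (Agree⇒SameOrbit (agree-beyond B≤x cx)))

  opaque
    forth : ∀ {n} {fs : Vec PC n} {u} → Tracks fs u → (a : Elem) → Σ PC λ ψ → Tracks (ψ ∷ fs) (a ∷ u)
    forth {fs = fs} {u} tracks a = Forth.ψ fs u tracks a , Forth.tracks-ψ fs u tracks a

    back : ∀ {n} {fs : Vec PC n} {u} → Tracks fs u → (ψ : PC) → Σ Elem λ a → Tracks (ψ ∷ fs) (a ∷ u)
    back {fs = fs} {u} tracks ψ = Back.a fs u tracks ψ , Back.tracks-ψ fs u tracks ψ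

module Construction {L : Language} (𝒜 : CompStructure L) (em : ExcludedMiddle 0ℓ)
                    (inf : CompStructure.InfiniteStructure 𝒜)
                    (ulf : UniformlyLocallyFinite (CompStructure.struct 𝒜))
                    (uh : Ultrahomogeneous (CompStructure.struct 𝒜))
                    (C : Pred) (coh : Cohesive C) where

  open Language L
  open CompStructure 𝒜
  open Terms 𝒜
  open CohesivePower 𝒜 C
  open PC

  a₀ : Elem
  a₀ = proj₁ (inf 0) , proj₂ (proj₂ (inf 0))

  open BackAndForth 𝒜 em ulf uh C coh a₀

  module Π = Structure (Π[ C ] 𝒜)

  constPC : Elem → PC
  constPC (c , d) = pc (constCode c) (λ x y ev → subst Dom (sym (constCode-det c x y ev)) d)
                       (0 , λ x _ _ → c , constCode-ev c x)

  -- Classical choice of a function with code number k, and junk where k codes nothing.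
  pcAt : ℕ → PC
  pcAt k with em {Σ PC λ φ → encode (code φ) ≡ k}
  ... | yes (φ , _) = φ
  ... | no _        = constPC a₀

  pcAt-encode : ∀ φ → code (pcAt (encode (code φ))) ≡ code φ
  pcAt-encode φ with em {Σ PC λ φ′ → encode (code φ′) ≡ encode (code φ)}
  ... | yes (_ , eq) = encode-injective eq
  ... | no none      = ⊥-elim (none (φ , refl))

  double : ℕ → ℕ
  double zero    = zero
  double (suc m) = suc (suc (double m))

  State : ℕ → Set
  State k = Σ (Vec Elem k) λ u → Σ (Vec PC k) λ fs → Tracks fs u

  stage : (m : ℕ) → State (double m)
  stage zero    = [] , [] , tracks-[]
  stage (suc m) =
    let (u , fs , tracks) = stage m
        (ψ , tracks′) = forth tracks (sel m)
        (a , tracks″) = back tracks′ (pcAt m)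
    in a ∷ sel m ∷ u , pcAt m ∷ ψ ∷ fs , tracks″

  elems : (m : ℕ) → Vec Elem (double m)
  elems m = proj₁ (stage m)

  funs : (m : ℕ) → Vec PC (double m)
  funs m = proj₁ (proj₂ (stage m))

  Slot : Set
  Slot = Σ ℕ λ m → Fin (double m)

  slotElem : Slot → Elem
  slotElem (m , i) = lookup (elems m) i

  slotPC : Slot → PC
  slotPC (m , i) = lookup (funs m) i

  lift : ∀ {m m′} → m ≤′ m′ → Fin (double m) → Fin (double m′)
  lift ≤′-refl       i = i
  lift (≤′-step m≤m′) i = suc (suc (lift m≤m′ i))

  lift-slot : ∀ {m m′} (m≤m′ : m ≤′ m′) i →
              lookup (elems m′) (lift m≤m′ i) ≡ lookup (elems m) i ×
              lookup (funs m′) (lift m≤m′ i) ≡ lookup (funs m) i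
  lift-slot ≤′-refl        i = refl , refl
  lift-slot (≤′-step m≤m′) i = lift-slot m≤m′ i

  -- Finitely many slots all live in one stage, whose invariant supplies a single automorphism.
  slots-conjugate : ∀ {r} (ss : Fin r → Slot) →
    C ⊆* λ x → Σ Aut λ σ → ∀ l → code (slotPC (ss l)) ⟨ x ⟩≃ proj₁ (Iso.h σ (slotElem (ss l)))
  slots-conjugate ss = proj₁ tracks , λ x b≤x cx →
    let (σ , ev) = proj₂ tracks x b≤x cx in
    σ , λ l → let m≤M = ≤⇒≤′ (≤-supremum (λ l → proj₁ (ss l)) l)
                  (elem≡ , fun≡) = lift-slot m≤M (proj₂ (ss l))
              in subst₂ (λ φ a → code φ ⟨ x ⟩≃ proj₁ (Iso.h σ a)) fun≡ elem≡
                        (ev (lift m≤M (proj₂ (ss l))))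
    where
    M : ℕ
    M = supremum (λ l → proj₁ (ss l))

    tracks : Tracks (funs M) (elems M)
    tracks = proj₂ (proj₂ (stage M))

  slotOf : Elem → Slot
  slotOf a = suc (proj₁ a) , suc zero

  Φ : Elem → PC
  Φ a = slotPC (slotOf a)

  elements-conjugate : ∀ {r} (xs : Vec Elem r) → C ⊆* λ x → Conjugate x (map Φ xs) xs
  elements-conjugate xs =
    let (b , conj) = slots-conjugate (λ l → slotOf (lookup xs l)) in
    b , λ x b≤x cx → let (σ , ev) = conj x b≤x cx in
    σ , λ l → subst₂ (λ φ y → code φ ⟨ x ⟩≃ y) (sym (lookup-map l Φ xs))
                     (Iso.h-cong σ (sel-id (proj₂ (lookup xs l)))) (ev l)

  pick : ∀ {X} → C ⊆* X → Σ ℕ λ x → C x × X x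
  pick = ⊆*-witness (proj₁ coh)

  Π-refl : ∀ φ → φ Π.≈ φ
  Π-refl φ = proj₁ (dom φ) , λ x b≤x cx → let (y , ev) = proj₂ (dom φ) x b≤x cx in y , ev , ev

  Φ-cong : ∀ {a b : Elem} → proj₁ a ≡ proj₁ b → Φ a Π.≈ Φ b
  Φ-cong {a} a≡b = subst (λ m → Φ a Π.≈ slotPC (suc m , suc zero)) a≡b (Π-refl (Φ a))

  Φ-inj : ∀ {a b : Elem} → Φ a Π.≈ Φ b → proj₁ a ≡ proj₁ b
  Φ-inj {a} {b} Φa≈Φb =
    let (x , _ , (σ , ev) , (y , eva , evb)) = pick (⊆*-∩ (elements-conjugate (a ∷ b ∷ [])) Φa≈Φb)
    in Iso.h-inj σ (trans (Eval-deterministic (ev zero) eva) (Eval-deterministic evb (ev (suc zero))))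

  -- ψ was adjoined by the back step of stage k + 1, k being its code number, opposite an element a.
  Φ-surj : ∀ ψ → Σ Elem λ a → Φ a Π.≈ ψ
  Φ-surj ψ = let (b , conj) = slots-conjugate slots in a , b , λ x b≤x cx →
      let (σ , ev) = conj x b≤x cx in
      proj₁ (Iso.h σ a) ,
      subst (code (Φ a) ⟨ x ⟩≃_) (Iso.h-cong σ (sel-id (proj₂ a))) (ev zero) ,
      subst (λ p → p ⟨ x ⟩≃ proj₁ (Iso.h σ a)) (pcAt-encode ψ) (ev (suc zero))
    where
    back-slot : Slot
    back-slot = suc (encode (code ψ)) , zero

    a : Elem
    a = slotElem back-slot

    slots : Fin 2 → Slot
    slots zero    = slotOf a
    slots (suc _) = back-slot

  Φ-rel : ∀ r xs → A.rel r xs ⇔ Π.rel r (map Φ xs)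
  Φ-rel r xs = mk⇔ to from
    where
    to : A.rel r xs → Π.rel r (map Φ xs)
    to ρ = let (b , conj) = elements-conjugate xs in b , λ x b≤x cx →
      let c@(σ , _) = conj x b≤x cx in
      raw (map (Iso.h σ) xs) , Conjugate-EvalV c , Equivalence.to (Iso.h-rel σ r xs) ρ

    from : Π.rel r (map Φ xs) → A.rel r xs
    from Πρ = let (x , _ , c@(σ , _) , (ys , evs , ρ)) = pick (⊆*-∩ (elements-conjugate xs) Πρ) in
      Equivalence.from (Iso.h-rel σ r xs)
        (subst (λ zs → Eval (relCode r) zs 1) (EvalV-deterministic evs (Conjugate-EvalV c)) ρ)

  Φ-fun : ∀ i xs → Φ (A.fun i xs) Π.≈ Π.fun i (map Φ xs)
  Φ-fun i xs = let (b , conj) = elements-conjugate (A.fun i xs ∷ xs) in b , λ x b≤x cx →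
    let (σ , ev) = conj x b≤x cx in
    proj₁ (Iso.h σ (A.fun i xs)) , ev zero ,
    subst (Eval (Cn (funCode i) (map code (map Φ xs))) (x ∷ [])) (sym (Iso.h-fun σ i xs))
          (evCn (Conjugate-EvalV (σ , λ l → ev (suc l))) (fun-eval i (map (Iso.h σ) xs)))

  Φ-con : ∀ c → Φ (A.con c) Π.≈ Π.con c
  Φ-con c = let (b , conj) = elements-conjugate (A.con c ∷ []) in b , λ x b≤x cx →
    let (σ , ev) = conj x b≤x cx in
    proj₁ (Iso.h σ (A.con c)) , ev zero ,
    subst (constCode (conVal c) ⟨ x ⟩≃_) (sym (Iso.h-con σ c)) (constCode-ev (conVal c) x)

  A≅Π : A ≅ (Π[ C ] 𝒜)
  A≅Π = record
    { h = Φ ; h-cong = λ {a b} → Φ-cong {a} {b} ; h-inj = λ {a b} → Φ-inj {a} {b} ; h-surj = Φ-surj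
    ; h-rel = Φ-rel ; h-fun = Φ-fun ; h-con = Φ-con }

proposition3p4 : ExcludedMiddle 0ℓ → {L : Language} (𝒜 : CompStructure L) →
    CompStructure.InfiniteStructure 𝒜 →
    UniformlyLocallyFinite (CompStructure.struct 𝒜) →
    Ultrahomogeneous (CompStructure.struct 𝒜) →
    (C : Pred) → Cohesive C →
    CompStructure.struct 𝒜 ≅ (Π[ C ] 𝒜)
proposition3p4 em 𝒜 inf ulf uh C coh = Construction.A≅Π 𝒜 em inf ulf uh C coh
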